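{- Let $p\ge2$, $n=3p-1$, and let $b,c$ be integers with $b\ge1$, $c\ge0$, $b+c\le p-2$. For $i\in\mathbb{Z}$ let $\overline i\in[n]$ with $\overline i\equiv i\pmod n$. Let $\Sigma=\langle\{\{\overline i,\overline{1+i},\overline{2+i}\}: i=1,\dots,n\}\rangle$, and for $1\le i\le n$, $1\le j\le p-2$ let $\Delta(i,j)=\langle\{\overline i,\overline{1+i},\overline{2+i+3j}\},\{\overline{1+i+3j},\overline{2+i+3j},\overline{1+i}\}\rangle$. Let $\mathcal L=\{\Delta(i,j)\}$, $\mathcal M=\mathcal L\setminus\{\Delta(1,1),\dots,\Delta(1,b)\}$, $\Gamma=\Sigma\cup\bigcup_{\Delta(i,j)\in\mathcal M}\Delta(i,j)$, $G_j=\{1,2+3j,3+3j\}$ for $1\le j\le p-2$, and $\Delta=\Gamma\cup\langle G_{b+1}\rangle\cup\cdots\cup\langle G_{b+c}\rangle$. Then (i) $\Delta\cap\langle G_b\rangle=\langle\{1,2+3b\},\{2+3b,3+3b\}\rangle$; (ii) $(\Delta\cup\langle G_b\rangle)\cap\langle\{1,2,3+3b\}\rangle=\langle\{1,2\},\{1,3+3b\}\rangle$.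
   Context: For a collection $C$ of subsets of $[n]$, $\langle C\rangle$ denotes the simplicial complex generated by $C$ (all subsets of members of $C$); $\langle F\rangle=\langle\{F\}\rangle$. -}

module Defs where

open import Data.Nat using (ℕ; suc; _+_; _*_; _∸_; _≤_; _%_)
open import Data.List using (List; []; _∷_; map; upTo)
open import Data.List.Relation.Unary.Any using (Any)
open import Data.List.Relation.Binary.Subset.Propositional using (_⊆_)
open import Data.Product using (Σ; _×_)
open import Data.Sum using (_⊎_)
open import Relation.Nullary using (¬_)

-- A face is a finite set of vertices, represented by a list of naturals
-- (duplicates/order irrelevant: all notions below only use membership).
Face : Set
Face = List ℕ

Complex : Set₁
Complex = Face → Set

⟨_⟩ : List Face → Complex
⟨ C ⟩ F = Any (F ⊆_) C

infixr 6 _∪_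
infixr 7 _∩_
infix 4 _≅_

_∪_ : Complex → Complex → Complex
(A ∪ B) F = A F ⊎ B F

_∩_ : Complex → Complex → Complex
(A ∩ B) F = A F × B F

_≅_ : Complex → Complex → Set
A ≅ B = (F : Face) → (A F → B F) × (B F → A F)

-- [a, b] as a list of naturals
range : ℕ → ℕ → List ℕ
range a b = map (a +_) (upTo (suc b ∸ a))

-- n = 3p - 1 (written as suc (3p - 2), equal to 3p - 1 for p ≥ 1)
nv : ℕ → ℕ
nv p = suc (3 * p ∸ 2)

-- bar p i : the element of [n] congruent to i mod n (for i ≥ 1)
bar : ℕ → ℕ → ℕ
bar p i = suc ((i ∸ 1) % nv p)

SigmaC : ℕ → Complex
SigmaC p = ⟨ map (λ i → bar p i ∷ bar p (1 + i) ∷ bar p (2 + i) ∷ []) (range 1 (nv p)) ⟩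

DeltaIJ : ℕ → ℕ → ℕ → Complex
DeltaIJ p i j =
  ⟨ (bar p i ∷ bar p (1 + i) ∷ bar p (2 + i + 3 * j) ∷ [])
  ∷ (bar p (1 + i + 3 * j) ∷ bar p (2 + i + 3 * j) ∷ bar p (1 + i) ∷ [])
  ∷ [] ⟩

InL : ℕ → ℕ → ℕ → Set
InL p i j = (1 ≤ i × i ≤ nv p) × (1 ≤ j × j ≤ p ∸ 2)

-- Δ(i,j) is a member of 𝓜 = 𝓛 ∖ {Δ(1,1),…,Δ(1,b)}  (set difference of complexes)
InM : ℕ → ℕ → ℕ → ℕ → Set
InM p b i j = InL p i j × ¬ (Σ ℕ λ k → (1 ≤ k × k ≤ b) × (DeltaIJ p i j ≅ DeltaIJ p 1 k))

GammaC : ℕ → ℕ → Complex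
GammaC p b F = SigmaC p F ⊎ (Σ ℕ λ i → Σ ℕ λ j → InM p b i j × DeltaIJ p i j F)

Gf : ℕ → Face
Gf j = 1 ∷ (2 + 3 * j) ∷ (3 + 3 * j) ∷ []

DeltaC : ℕ → ℕ → ℕ → Complex
DeltaC p b c = GammaC p b ∪ ⟨ map Gf (range (1 + b) (b + c)) ⟩

module Submission where

-- Write p = 2 + q, so that n = 3p - 1 = 5 + 3q, and note b ≤ q.  Both parts
-- follow from two facts about the complex Δ:
--   (a) it contains the edges {2+3b, 3+3b} and {1, 2} (both in Σ) and
--       {1, 2+3b} (in the facet {n, 1, 2+3b} of Δ(n,b), which lies in 𝓜);
--   (b) no face of Δ contains both y and 3+3b, for y ∈ {1, 2}.
-- For (b), two vertices of a common facet of Σ or of Δ(i,j) sit at cyclic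
-- positions v and v + D with D = 3m + d (d ≤ 2, m ≤ q).  Reducing modulo n
-- (`cyclic-gap`) and then modulo 3 (`gap-no-wrap`, `gap-wrap`) shows that
-- {y, 3+3b} can only arise as an edge of Δ(1,b) or of Δ(2+3b, p-1-b), and
-- the latter is again Δ(1,b) (`twin`); both are excluded from 𝓜.  The G_k
-- with k > b do not contain 3+3b at all.  Finally, a face of a triangle that
-- avoids one of its edges lies in one of the other two edges (`cut-path`),
-- so intersecting with ⟨G_b⟩, resp. ⟨{1,2,3+3b}⟩, leaves exactly the two
-- edges from (a) (`restrict-to-triangle`).

open import Defs
open import Data.Nat using (ℕ; suc; _+_; _*_; _∸_; _≤_; _<_; _%_; z≤n; s≤s; NonZero; _<?_; _≟_)
open import Data.Nat.Properties
open import Data.Nat.DivMod using (m<n⇒m%n≡m; [m+kn]%n≡m%n; [m+n]%n≡m%n; n%n≡0; %-distribˡ-+; m≤n⇒[n∸m]%m≡n%m; m%n<n)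
open import Data.Nat.Tactic.RingSolver using (solve)
open import Data.List using ([]; _∷_)
open import Data.List.Relation.Unary.Any using (here; there)
import Data.List.Relation.Unary.Any.Properties as Any
open import Data.List.Membership.Propositional using (_∈_; find; lose)
open import Data.List.Membership.Propositional.Properties using (∈-upTo⁺)
open import Data.List.Membership.DecPropositional _≟_ using (_∈?_)
open import Data.List.Relation.Binary.Subset.Propositional using (_⊆_)
open import Data.List.Relation.Binary.Subset.Propositional.Properties using (⊆-trans; ⊆-reflexive-↭)
open import Data.List.Relation.Binary.Permutation.Propositional using (swap; ↭-refl)
open import Data.Product using (Σ; _×_; _,_; proj₁; map₂; uncurry)
open import Data.Sum using (_⊎_; inj₁; inj₂; [_,_]′)
import Data.Sum as Sum
open import Data.Empty using (⊥; ⊥-elim)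
open import Relation.Nullary using (¬_; yes; no)
open import Relation.Binary.PropositionalEquality
  using (_≡_; _≢_; refl; sym; trans; cong; cong₂; subst; subst₂; module ≡-Reasoning)

mod3-unique : ∀ r s a c → r < 3 → s < 3 → r + 3 * a ≡ s + 3 * c → r ≡ s × a ≡ c
mod3-unique r s a c r<3 s<3 eq =
  r≡s , *-cancelˡ-≡ a c 3 (+-cancelˡ-≡ r _ _ (trans eq (cong (_+ 3 * c) (sym r≡s))))
  where
  open ≡-Reasoning
  r≡s : r ≡ s
  r≡s = begin
    r               ≡⟨ m<n⇒m%n≡m r<3 ⟨
    r % 3           ≡⟨ [m+kn]%n≡m%n r a 3 ⟨
    (r + a * 3) % 3 ≡⟨ cong (λ k → (r + k) % 3) (*-comm a 3) ⟩
    (r + 3 * a) % 3 ≡⟨ cong (_% 3) eq ⟩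
    (s + 3 * c) % 3 ≡⟨ cong (λ k → (s + k) % 3) (*-comm 3 c) ⟩
    (s + c * 3) % 3 ≡⟨ [m+kn]%n≡m%n s c 3 ⟩
    s % 3           ≡⟨ m<n⇒m%n≡m s<3 ⟩
    s               ∎

three-times-suc : ∀ b → 3 + 3 * b ≡ 3 * (1 + b)
three-times-suc b = sym (*-distribˡ-+ 3 1 b)

digit-sum : ∀ s m b → s ≤ 3 → 1 + s + 3 * m ≡ 3 + 3 * b → s ≡ 2 × m ≡ b
digit-sum 0 m b _ eq with () ← proj₁
  (mod3-unique 1 0 m (1 + b) (s≤s (s≤s z≤n)) (s≤s z≤n) (trans eq (three-times-suc b)))
digit-sum 1 m b _ eq with () ← proj₁
  (mod3-unique 2 0 m (1 + b) (s≤s (s≤s (s≤s z≤n))) (s≤s z≤n) (trans eq (three-times-suc b)))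
digit-sum 2 m b _ eq = refl , *-cancelˡ-≡ m b 3 (+-cancelˡ-≡ 3 _ _ eq)
digit-sum 3 m b _ eq with () ← proj₁
  (mod3-unique 1 0 m b (s≤s (s≤s z≤n)) (s≤s z≤n) (suc-injective (suc-injective (suc-injective eq))))
digit-sum (suc (suc (suc (suc _)))) _ _ (s≤s (s≤s (s≤s ()))) _

-- The two arithmetic shapes of a gap D = 3m + d between the vertices 1+e and 3+3b:
-- without wrap-around it must be 3b + 2 - e, ...
gap-no-wrap : ∀ e d m b → e ≤ 1 → d ≤ 2 → (1 + e) + (3 * m + d) ≡ 3 + 3 * b → d + e ≡ 2 × m ≡ b
gap-no-wrap e d m b e≤1 d≤2 eq = digit-sum (d + e) m b (+-mono-≤ d≤2 e≤1) (begin
  1 + (d + e) + 3 * m ≡⟨ solve (e ∷ d ∷ m ∷ []) ⟩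
  (1 + e) + (3 * m + d) ≡⟨ eq ⟩
  3 + 3 * b ∎)
  where open ≡-Reasoning

-- ... and with one wrap-around (n = 5 + 3q) it must be n - (3b + 2 - e).
gap-wrap : ∀ e d m b q → e ≤ 1 → d ≤ 2 → (3 + 3 * b) + (3 * m + d) ≡ (1 + e) + (5 + 3 * q) →
  d ≡ e × b + m ≡ 1 + q
gap-wrap e d m b q e≤1 d≤2 eq = map₂ suc-injective
  (mod3-unique d e (1 + b + m) (2 + q) (s≤s d≤2) (s≤s (≤-trans e≤1 (s≤s z≤n))) (begin
    d + 3 * (1 + b + m)       ≡⟨ solve (d ∷ b ∷ m ∷ []) ⟩
    (3 + 3 * b) + (3 * m + d) ≡⟨ eq ⟩
    (1 + e) + (5 + 3 * q)     ≡⟨ solve (e ∷ q ∷ []) ⟩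
    e + 3 * (2 + q)           ∎))
  where open ≡-Reasoning

%-add-small : ∀ a D n .{{_ : NonZero n}} → D < n → (a + D) % n ≡ (a % n + D) % n
%-add-small a D n D<n = trans (%-distribˡ-+ a D n) (cong (λ k → (a % n + k) % n) (m<n⇒m%n≡m D<n))

%-shift : ∀ a D n .{{_ : NonZero n}} → D < n →
  (a + D) % n ≡ a % n + D ⊎ (a + D) % n + n ≡ a % n + D
%-shift a D n D<n with a % n + D <? n
... | yes s<n = inj₁ (begin
  (a + D) % n           ≡⟨ %-add-small a D n D<n ⟩
  (a % n + D) % n       ≡⟨ m<n⇒m%n≡m s<n ⟩
  a % n + D             ∎)
  where open ≡-Reasoning
... | no s≮n = inj₂ (begin
  (a + D) % n + n           ≡⟨ cong (_+ n) (%-add-small a D n D<n) ⟩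
  (a % n + D) % n + n       ≡⟨ cong (_+ n) (m≤n⇒[n∸m]%m≡n%m n≤s) ⟨
  (a % n + D ∸ n) % n + n   ≡⟨ cong (_+ n) (m<n⇒m%n≡m (m<n+o⇒m∸n<o _ n s<2n)) ⟩
  a % n + D ∸ n + n         ≡⟨ m∸n+n≡m n≤s ⟩
  a % n + D                 ∎)
  where
  open ≡-Reasoning
  n≤s : n ≤ a % n + D
  n≤s = ≮⇒≥ s≮n
  s<2n : a % n + D < n + n
  s<2n = +-mono-< (m%n<n a n) D<n

Pair : ℕ → ℕ → ℕ → ℕ → Set
Pair y x a c = (a ≡ y × c ≡ x) ⊎ (a ≡ x × c ≡ y)

Pair-swap : ∀ {y x a c} → Pair y x a c → Pair y x c a
Pair-swap (inj₁ (a≡y , c≡x)) = inj₂ (c≡x , a≡y)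
Pair-swap (inj₂ (a≡x , c≡y)) = inj₁ (c≡y , a≡x)

pair-in-triple : ∀ {y x u₁ u₂ u₃} → y ≢ x → y ∈ u₁ ∷ u₂ ∷ u₃ ∷ [] → x ∈ u₁ ∷ u₂ ∷ u₃ ∷ [] →
  Pair y x u₁ u₂ ⊎ Pair y x u₁ u₃ ⊎ Pair y x u₂ u₃
pair-in-triple y≢x (here a) (here c) = ⊥-elim (y≢x (trans a (sym c)))
pair-in-triple y≢x (here a) (there (here c)) = inj₁ (inj₁ (sym a , sym c))
pair-in-triple y≢x (here a) (there (there (here c))) = inj₂ (inj₁ (inj₁ (sym a , sym c)))
pair-in-triple y≢x (there (here a)) (here c) = inj₁ (inj₂ (sym c , sym a))
pair-in-triple y≢x (there (here a)) (there (here c)) = ⊥-elim (y≢x (trans a (sym c)))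
pair-in-triple y≢x (there (here a)) (there (there (here c))) = inj₂ (inj₂ (inj₁ (sym a , sym c)))
pair-in-triple y≢x (there (there (here a))) (here c) = inj₂ (inj₁ (inj₂ (sym c , sym a)))
pair-in-triple y≢x (there (there (here a))) (there (here c)) = inj₂ (inj₂ (inj₂ (sym c , sym a)))
pair-in-triple y≢x (there (there (here a))) (there (there (here c))) = ⊥-elim (y≢x (trans a (sym c)))

cut-path : ∀ {F : Face} {u v w} → F ⊆ u ∷ v ∷ w ∷ [] → (u ∈ F → w ∈ F → ⊥) →
  F ⊆ u ∷ v ∷ [] ⊎ F ⊆ v ∷ w ∷ []
cut-path {F} {u} {v} {w} F⊆uvw not-both with w ∈? F
... | yes w∈F = inj₂ (λ z∈F → drop-u z∈F (F⊆uvw z∈F))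
  where
  drop-u : ∀ {z} → z ∈ F → z ∈ u ∷ v ∷ w ∷ [] → z ∈ v ∷ w ∷ []
  drop-u z∈F (here z≡u) = ⊥-elim (not-both (subst (_∈ F) z≡u z∈F) w∈F)
  drop-u z∈F (there z∈vw) = z∈vw
... | no w∉F = inj₁ (λ z∈F → drop-w z∈F (F⊆uvw z∈F))
  where
  drop-w : ∀ {z} → z ∈ F → z ∈ u ∷ v ∷ w ∷ [] → z ∈ u ∷ v ∷ []
  drop-w z∈F (here z≡u) = here z≡u
  drop-w z∈F (there (here z≡v)) = there (here z≡v)
  drop-w z∈F (there (there (here z≡w))) = ⊥-elim (w∉F (subst (_∈ F) z≡w z∈F))

restrict-to-triangle : (K : Complex) {T E₁ E₂ : Face} → E₁ ⊆ T → E₂ ⊆ T →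
  (∀ {F} → F ⊆ E₁ → K F) → (∀ {F} → F ⊆ E₂ → K F) →
  (∀ {F} → K F → F ⊆ T → F ⊆ E₁ ⊎ F ⊆ E₂) →
  K ∩ ⟨ T ∷ [] ⟩ ≅ ⟨ E₁ ∷ E₂ ∷ [] ⟩
restrict-to-triangle K E₁⊆T E₂⊆T K-E₁ K-E₂ split F = to , from
  where
  to : (K ∩ ⟨ _ ∷ [] ⟩) F → ⟨ _ ∷ _ ∷ [] ⟩ F
  to (KF , here F⊆T) = [ here , (λ F⊆E₂ → there (here F⊆E₂)) ]′ (split KF F⊆T)
  from : ⟨ _ ∷ _ ∷ [] ⟩ F → (K ∩ ⟨ _ ∷ [] ⟩) F
  from (here F⊆E₁) = K-E₁ F⊆E₁ , here (⊆-trans F⊆E₁ E₁⊆T)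
  from (there (here F⊆E₂)) = K-E₂ F⊆E₂ , here (⊆-trans F⊆E₂ E₂⊆T)

⟨⟩-swap : ∀ A B → ⟨ A ∷ B ∷ [] ⟩ ≅ ⟨ B ∷ A ∷ [] ⟩
⟨⟩-swap A B F = flip , flip
  where
  flip : ∀ {A B} → ⟨ A ∷ B ∷ [] ⟩ F → ⟨ B ∷ A ∷ [] ⟩ F
  flip (here F⊆A) = there (here F⊆A)
  flip (there (here F⊆B)) = here F⊆B

G-contains-top : ∀ {b k} → 3 + 3 * b ∈ Gf k → k ≡ b
G-contains-top (here ())
G-contains-top {b} {k} (there (here eq)) with () ← proj₁
  (mod3-unique 0 2 (1 + b) k (s≤s z≤n) (s≤s (s≤s (s≤s z≤n))) (trans (sym (three-times-suc b)) eq))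
G-contains-top {b} {k} (there (there (here eq))) = sym (*-cancelˡ-≡ b k 3 (+-cancelˡ-≡ 3 _ _ eq))

2∉G : ∀ {b} → 1 ≤ b → 2 ∈ Gf b → ⊥
2∉G (s≤s z≤n) (there (here ()))
2∉G (s≤s z≤n) (there (there (here ())))

module Cycle (q : ℕ) where

  p : ℕ
  p = 2 + q

  N : ℕ
  N = nv p

  N≡ : N ≡ 5 + 3 * q
  N≡ = cong (λ z → suc (z ∸ 2)) (*-distribˡ-+ 3 2 q)

  bar-id : ∀ {v} → 1 ≤ v → v ≤ N → bar p v ≡ v
  bar-id {suc v} _ v<N = cong suc (m<n⇒m%n≡m v<N)

  bar-periodic : ∀ v → 1 ≤ v → bar p (v + N) ≡ bar p v
  bar-periodic (suc v) _ = cong suc ([m+n]%n≡m%n v N)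

  bar-shift : ∀ {v} D → 1 ≤ v → D < N → bar p (v + D) ≡ bar p v + D ⊎ bar p (v + D) + N ≡ bar p v + D
  bar-shift {suc v} D _ D<N = Sum.map (cong suc) (cong suc) (%-shift v D N D<N)

  bar-suc : ∀ {i t} → i ≤ N → 2 ≤ t → bar p (1 + i) ≡ t → 1 + i ≡ t
  bar-suc i≤N 2≤t eq with m≤n⇒m<n∨m≡n i≤N
  ... | inj₁ i<N = trans (sym (bar-id (s≤s z≤n) i<N)) eq
  ... | inj₂ refl = ⊥-elim (<⇒≢ 2≤t (trans (cong suc (sym (n%n≡0 N))) eq))

  cyclic-gap : ∀ {v D y x} → 1 ≤ v → D < N → y < x → Pair y x (bar p v) (bar p (v + D)) →
    (bar p v ≡ y × y + D ≡ x) ⊎ (bar p v ≡ x × x + D ≡ y + N)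
  cyclic-gap {v} {D} {y} {x} 1≤v D<N y<x pair with bar-shift D 1≤v D<N | pair
  ... | inj₁ s | inj₁ (a , c) = inj₁ (a , sym (subst₂ (λ r t → t ≡ r + D) a c s))
  ... | inj₁ s | inj₂ (a , c) = ⊥-elim (<⇒≱ y<x (≤-trans (m≤m+n x D) (≤-reflexive x+D≡y)))
    where
    x+D≡y : x + D ≡ y
    x+D≡y = sym (subst₂ (λ r t → t ≡ r + D) a c s)
  ... | inj₂ s | inj₁ (a , c) = ⊥-elim (<⇒≢ (+-mono-< y<x D<N) (sym (subst₂ (λ r t → t + N ≡ r + D) a c s)))
  ... | inj₂ s | inj₂ (a , c) = inj₂ (a , sym (subst₂ (λ r t → t + N ≡ r + D) a c s))

  top<N : ∀ {k} → k ≤ q → 3 + 3 * k < N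
  top<N {k} k≤q = begin-strict
    3 + 3 * k ≤⟨ +-monoʳ-≤ 3 (*-monoʳ-≤ 3 k≤q) ⟩
    3 + 3 * q <⟨ +-monoˡ-< (3 * q) {3} {5} (s≤s (s≤s (s≤s (s≤s z≤n)))) ⟩
    5 + 3 * q ≡⟨ N≡ ⟨
    N         ∎
    where open ≤-Reasoning

  mid<N : ∀ {k} → k ≤ q → 2 + 3 * k < N
  mid<N k≤q = <-trans (n<1+n _) (top<N k≤q)

  gap<N : ∀ {m d} → m ≤ q → d ≤ 2 → 3 * m + d < N
  gap<N {m} {d} m≤q d≤2 = begin-strict
    3 * m + d ≤⟨ +-monoʳ-≤ (3 * m) d≤2 ⟩
    3 * m + 2 <⟨ +-monoʳ-< (3 * m) (n<1+n 2) ⟩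
    3 * m + 3 ≡⟨ +-comm (3 * m) 3 ⟩
    3 + 3 * m <⟨ top<N m≤q ⟩
    N         ∎
    where open ≤-Reasoning

  -- The forbidden edge {1+e, 3+3b} (e ≤ 1) at positions v and v + (3m + d) is possible only
  -- directly (v carries 1+e, gap 3b + 2 - e) or wrapped (v carries 3+3b, gap n - 3b - 2 + e).
  data EdgeAt (b e m d v : ℕ) : Set where
    direct  : bar p v ≡ 1 + e → d + e ≡ 2 → m ≡ b → EdgeAt b e m d v
    wrapped : bar p v ≡ 3 + 3 * b → d ≡ e → b + m ≡ 1 + q → EdgeAt b e m d v

  edge-ordered : ∀ {e b} → e ≤ 1 → 1 + e < 3 + 3 * b
  edge-ordered e≤1 = s≤s (s≤s (≤-trans e≤1 (s≤s z≤n)))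

  edge-at : ∀ b v {e m d w} → e ≤ 1 → d ≤ 2 → m ≤ q → 1 ≤ v → w ≡ v + (3 * m + d) →
    Pair (1 + e) (3 + 3 * b) (bar p v) (bar p w) → EdgeAt b e m d v
  edge-at b v {e} {m} {d} e≤1 d≤2 m≤q 1≤v refl pair
    with cyclic-gap 1≤v (gap<N m≤q d≤2) (edge-ordered {b = b} e≤1) pair
  ... | inj₁ (at , eq) = uncurry (direct at) (gap-no-wrap e d m b e≤1 d≤2 eq)
  ... | inj₂ (at , eq) = uncurry (wrapped at) (gap-wrap e d m b q e≤1 d≤2 (trans eq (cong ((1 + e) +_) N≡)))

  no-short-edge : ∀ {b e d v} → 1 ≤ b → b ≤ q → ¬ EdgeAt b e 0 d v
  no-short-edge 1≤b _ (direct _ _ 0≡b) = <⇒≢ 1≤b 0≡b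
  no-short-edge {b} _ b≤q (wrapped _ _ b+0≡1+q) = 1+n≰n (subst (_≤ q) (trans (sym (+-identityʳ b)) b+0≡1+q) b≤q)

  sigma-facet : ℕ → Face
  sigma-facet t = bar p t ∷ bar p (1 + t) ∷ bar p (2 + t) ∷ []

  sigma-avoids : ∀ {b e t} → 1 ≤ b → b ≤ q → e ≤ 1 → 1 ≤ t →
    1 + e ∈ sigma-facet t → 3 + 3 * b ∈ sigma-facet t → ⊥
  sigma-avoids {b} {e} {t} 1≤b b≤q e≤1 1≤t y∈ x∈ with pair-in-triple (<⇒≢ (edge-ordered {b = b} e≤1)) y∈ x∈
  ... | inj₁ P = no-short-edge 1≤b b≤q (edge-at b t e≤1 (s≤s z≤n) z≤n 1≤t (+-comm 1 t) P)
  ... | inj₂ (inj₁ P) = no-short-edge 1≤b b≤q (edge-at b t e≤1 ≤-refl z≤n 1≤t (+-comm 2 t) P)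
  ... | inj₂ (inj₂ P) = no-short-edge 1≤b b≤q (edge-at b (1 + t) e≤1 (s≤s z≤n) z≤n (s≤s z≤n) (+-comm 1 (1 + t)) P)

  facet₁ facet₂ : ℕ → ℕ → Face
  facet₁ i j = bar p i ∷ bar p (1 + i) ∷ bar p (2 + i + 3 * j) ∷ []
  facet₂ i j = bar p (1 + i + 3 * j) ∷ bar p (2 + i + 3 * j) ∷ bar p (1 + i) ∷ []

  -- Δ(i,j) is Δ(1,b), presented either as itself or as Δ(2+3b, p-1-b).
  Twin : ℕ → ℕ → ℕ → Set
  Twin b i j = (i ≡ 1 × j ≡ b) ⊎ (i ≡ 2 + 3 * b × b + j ≡ 1 + q)

  -- Reading off i (and j) from where the forbidden edge sits in a facet of Δ(i,j):
  -- position 1+i carrying 3+3b gives the twin presentation; the gaps 2, 1, 0 refer to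
  -- the pairs (i, 2+i+3j), (1+i, 2+i+3j) and (1+i, 1+i+3j) respectively.
  twin-at-suc : ∀ {b i j} → i ≤ N → bar p (1 + i) ≡ 3 + 3 * b → b + j ≡ 1 + q → Twin b i j
  twin-at-suc i≤N at b+j = inj₂ (suc-injective (bar-suc i≤N (s≤s (s≤s z≤n)) at) , b+j)

  twin-from-gap₂ : ∀ {b e i j} → e ≤ 1 → 1 ≤ i → i ≤ N → EdgeAt b e j 2 i → Twin b i j
  twin-from-gap₂ {e = e} _ 1≤i i≤N (direct at 2+e≡2 j≡b) =
    inj₁ (trans (sym (bar-id 1≤i i≤N)) (trans at (cong suc (+-cancelˡ-≡ 2 e 0 2+e≡2))) , j≡b)
  twin-from-gap₂ e≤1 _ _ (wrapped _ refl _) = ⊥-elim (1+n≰n e≤1)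

  twin-from-gap₁ : ∀ {b e i j} → i ≤ N → EdgeAt b e j 1 (1 + i) → Twin b i j
  twin-from-gap₁ i≤N (direct at 1+e≡2 j≡b) =
    inj₁ (suc-injective (bar-suc i≤N (s≤s (s≤s z≤n)) (trans at 1+e≡2)) , j≡b)
  twin-from-gap₁ i≤N (wrapped at _ b+j) = twin-at-suc i≤N at b+j

  twin-from-gap₀ : ∀ {b e i j} → e ≤ 1 → i ≤ N → EdgeAt b e j 0 (1 + i) → Twin b i j
  twin-from-gap₀ e≤1 _ (direct _ refl _) = ⊥-elim (1+n≰n e≤1)
  twin-from-gap₀ _ i≤N (wrapped at _ b+j) = twin-at-suc i≤N at b+j

  offset₂ : ∀ i j → 2 + i + 3 * j ≡ i + (3 * j + 2)
  offset₂ i j = solve (i ∷ j ∷ [])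

  offset₁ : ∀ i j → 2 + i + 3 * j ≡ (1 + i) + (3 * j + 1)
  offset₁ i j = solve (i ∷ j ∷ [])

  offset₀ : ∀ i j → 1 + i + 3 * j ≡ (1 + i) + (3 * j + 0)
  offset₀ i j = solve (i ∷ j ∷ [])

  facet₁-edge : ∀ {b e i j} → 1 ≤ b → b ≤ q → e ≤ 1 → 1 ≤ i → i ≤ N → j ≤ q →
    1 + e ∈ facet₁ i j → 3 + 3 * b ∈ facet₁ i j → Twin b i j
  facet₁-edge {b} {e} {i} {j} 1≤b b≤q e≤1 1≤i i≤N j≤q y∈ x∈
    with pair-in-triple (<⇒≢ (edge-ordered {b = b} e≤1)) y∈ x∈
  ... | inj₁ P = ⊥-elim (no-short-edge 1≤b b≤q (edge-at b i e≤1 (s≤s z≤n) z≤n 1≤i (+-comm 1 i) P))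
  ... | inj₂ (inj₁ P) = twin-from-gap₂ e≤1 1≤i i≤N (edge-at b i e≤1 ≤-refl j≤q 1≤i (offset₂ i j) P)
  ... | inj₂ (inj₂ P) = twin-from-gap₁ i≤N (edge-at b (1 + i) e≤1 (s≤s z≤n) j≤q (s≤s z≤n) (offset₁ i j) P)

  facet₂-edge : ∀ {b e i j} → 1 ≤ b → b ≤ q → e ≤ 1 → i ≤ N → j ≤ q →
    1 + e ∈ facet₂ i j → 3 + 3 * b ∈ facet₂ i j → Twin b i j
  facet₂-edge {b} {e} {i} {j} 1≤b b≤q e≤1 i≤N j≤q y∈ x∈
    with pair-in-triple (<⇒≢ (edge-ordered {b = b} e≤1)) y∈ x∈
  ... | inj₁ P = ⊥-elim (no-short-edge 1≤b b≤q (edge-at b (1 + i + 3 * j) e≤1 (s≤s z≤n) z≤n (s≤s z≤n) (+-comm 1 (1 + i + 3 * j)) P))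
  ... | inj₂ (inj₁ P) = twin-from-gap₀ e≤1 i≤N (edge-at b (1 + i) e≤1 z≤n j≤q (s≤s z≤n) (offset₀ i j) (Pair-swap P))
  ... | inj₂ (inj₂ P) = twin-from-gap₁ i≤N (edge-at b (1 + i) e≤1 (s≤s z≤n) j≤q (s≤s z≤n) (offset₁ i j) (Pair-swap P))

  -- Δ(2+3b, j) = Δ(1,b) when b + j = p - 1: its two facets are those of Δ(1,b), swapped.
  twin : ∀ {b j} → b + j ≡ 1 + q → DeltaIJ p (2 + 3 * b) j ≅ DeltaIJ p 1 b
  twin {b} {j} b+j =
    subst₂ (λ A B → ⟨ A ∷ B ∷ [] ⟩ ≅ DeltaIJ p 1 b) (sym facet₁-twin) (sym facet₂-twin)
      (⟨⟩-swap (facet₂ 1 b) (facet₁ 1 b))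
    where
    open ≡-Reasoning
    wraps : ∀ k → k + (2 + 3 * b) + 3 * j ≡ k + N
    wraps k = begin
      k + (2 + 3 * b) + 3 * j ≡⟨ solve (k ∷ b ∷ j ∷ []) ⟩
      k + 2 + 3 * (b + j)     ≡⟨ cong (λ s → k + 2 + 3 * s) b+j ⟩
      k + 2 + 3 * (1 + q)     ≡⟨ solve (k ∷ q ∷ []) ⟩
      k + (5 + 3 * q)         ≡⟨ cong (k +_) N≡ ⟨
      k + N                   ∎
    bar-wraps : ∀ k → 1 ≤ k → bar p (k + (2 + 3 * b) + 3 * j) ≡ bar p k
    bar-wraps k 1≤k = trans (cong (bar p) (wraps k)) (bar-periodic k 1≤k)
    facet₁-twin : facet₁ (2 + 3 * b) j ≡ facet₂ 1 b
    facet₁-twin = cong (λ z → bar p (2 + 3 * b) ∷ bar p (3 + 3 * b) ∷ z ∷ []) (bar-wraps 2 (s≤s z≤n))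
    facet₂-twin : facet₂ (2 + 3 * b) j ≡ facet₁ 1 b
    facet₂-twin = cong₂ (λ u w → u ∷ w ∷ bar p (3 + 3 * b) ∷ []) (bar-wraps 1 (s≤s z≤n)) (bar-wraps 2 (s≤s z≤n))

  twin-≅ : ∀ {b i j} → Twin b i j → DeltaIJ p i j ≅ DeltaIJ p 1 b
  twin-≅ (inj₁ (refl , refl)) F = (λ z → z) , (λ z → z)
  twin-≅ {b} {j = j} (inj₂ (refl , b+j)) = twin {b} {j} b+j

  Delta-avoids : ∀ {b c e F} → 1 ≤ b → b ≤ q → e ≤ 1 → DeltaC p b c F →
    1 + e ∈ F → 3 + 3 * b ∈ F → ⊥
  Delta-avoids 1≤b b≤q e≤1 (inj₁ (inj₁ σ)) y∈F x∈F with find (Any.map⁻ (Any.map⁻ σ))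
  ... | _ , _ , F⊆ = sigma-avoids 1≤b b≤q e≤1 (s≤s z≤n) (F⊆ y∈F) (F⊆ x∈F)
  Delta-avoids {b} 1≤b b≤q e≤1 (inj₁ (inj₂ (i , j , (((1≤i , i≤N) , (_ , j≤q)) , ∉M) , δ))) y∈F x∈F =
    ∉M (b , (1≤b , ≤-refl) , twin-≅ (in-facet δ))
    where
    in-facet : DeltaIJ p i j _ → Twin b i j
    in-facet (here F⊆) = facet₁-edge 1≤b b≤q e≤1 1≤i i≤N j≤q (F⊆ y∈F) (F⊆ x∈F)
    in-facet (there (here F⊆)) = facet₂-edge 1≤b b≤q e≤1 i≤N j≤q (F⊆ y∈F) (F⊆ x∈F)
  Delta-avoids {b} 1≤b b≤q e≤1 (inj₂ g) y∈F x∈F with find (Any.map⁻ (Any.map⁻ g))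
  ... | _ , _ , F⊆ = m≢1+m+n b (sym (G-contains-top (F⊆ x∈F)))

  -- Δ(n,b) belongs to 𝓜: the vertex n lies in it, but every vertex of Δ(1,k) is at most 3 + 3k < n.
  Delta-n-in-M : ∀ {b} → 1 ≤ b → b ≤ q → InM p b N b
  Delta-n-in-M {b} 1≤b b≤q = ((s≤s z≤n , ≤-refl) , (1≤b , b≤q)) , not-Δ1k
    where
    n∈Δnb : DeltaIJ p N b (N ∷ [])
    n∈Δnb = here (λ { (here refl) → here (sym (bar-id (s≤s z≤n) ≤-refl)) })
    small : ∀ {k w} → k ≤ q → 1 ≤ w → w ≤ 3 + 3 * k → bar p w ≤ 3 + 3 * k
    small k≤q 1≤w w≤ = subst (_≤ _) (sym (bar-id 1≤w (≤-trans w≤ (<⇒≤ (top<N k≤q))))) w≤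
    vertices-small : ∀ {k v} → k ≤ q → v ∈ facet₁ 1 k ⊎ v ∈ facet₂ 1 k → v ≤ 3 + 3 * k
    vertices-small k≤q (inj₁ (here refl)) = small k≤q (s≤s z≤n) (s≤s z≤n)
    vertices-small k≤q (inj₁ (there (here refl))) = small k≤q (s≤s z≤n) (s≤s (s≤s z≤n))
    vertices-small k≤q (inj₁ (there (there (here refl)))) = small k≤q (s≤s z≤n) ≤-refl
    vertices-small k≤q (inj₂ (here refl)) = small k≤q (s≤s z≤n) (n≤1+n _)
    vertices-small k≤q (inj₂ (there (here refl))) = small k≤q (s≤s z≤n) ≤-refl
    vertices-small k≤q (inj₂ (there (there (here refl)))) = small k≤q (s≤s z≤n) (s≤s (s≤s z≤n))
    vertex-of : ∀ {k v} → DeltaIJ p 1 k (v ∷ []) → v ∈ facet₁ 1 k ⊎ v ∈ facet₂ 1 k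
    vertex-of (here v⊆) = inj₁ (v⊆ (here refl))
    vertex-of (there (here v⊆)) = inj₂ (v⊆ (here refl))
    not-Δ1k : ¬ Σ ℕ (λ k → (1 ≤ k × k ≤ b) × (DeltaIJ p N b ≅ DeltaIJ p 1 k))
    not-Δ1k (k , (_ , k≤b) , iso) =
      <⇒≱ (top<N k≤q) (vertices-small k≤q (vertex-of {k} (proj₁ (iso (N ∷ [])) n∈Δnb)))
      where
      k≤q : k ≤ q
      k≤q = ≤-trans k≤b b≤q

  sigma-in-Delta : ∀ {b c F} t → t < N → F ⊆ sigma-facet (1 + t) → DeltaC p b c F
  sigma-in-Delta t t<N F⊆ = inj₁ (inj₁ (Any.map⁺ (Any.map⁺ (lose (∈-upTo⁺ t<N) F⊆))))

  edge-1-mid : ∀ {b c F} → 1 ≤ b → b ≤ q → F ⊆ 1 ∷ 2 + 3 * b ∷ [] → DeltaC p b c F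
  edge-1-mid {b} 1≤b b≤q F⊆ = inj₁ (inj₂ (N , b , Delta-n-in-M 1≤b b≤q , here (⊆-trans F⊆ edge⊆facet)))
    where
    edge⊆facet : 1 ∷ 2 + 3 * b ∷ [] ⊆ facet₁ N b
    edge⊆facet (here refl) = there (here (sym (bar-periodic 1 (s≤s z≤n))))
    edge⊆facet (there (here refl)) = there (there (here (sym (begin
      bar p (2 + N + 3 * b)   ≡⟨ cong (λ k → bar p (2 + k)) (+-comm N (3 * b)) ⟩
      bar p (2 + 3 * b + N)   ≡⟨ bar-periodic (2 + 3 * b) (s≤s z≤n) ⟩
      bar p (2 + 3 * b)       ≡⟨ bar-id (s≤s z≤n) (<⇒≤ (mid<N b≤q)) ⟩
      2 + 3 * b               ∎))))
      where open ≡-Reasoning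

  edge-mid-top : ∀ {b c F} → b ≤ q → F ⊆ 2 + 3 * b ∷ 3 + 3 * b ∷ [] → DeltaC p b c F
  edge-mid-top {b} b≤q F⊆ = sigma-in-Delta (1 + 3 * b) (<-trans (n<1+n _) (mid<N b≤q)) (⊆-trans F⊆ edge⊆facet)
    where
    edge⊆facet : 2 + 3 * b ∷ 3 + 3 * b ∷ [] ⊆ sigma-facet (2 + 3 * b)
    edge⊆facet (here refl) = here (sym (bar-id (s≤s z≤n) (<⇒≤ (mid<N b≤q))))
    edge⊆facet (there (here refl)) = there (here (sym (bar-id (s≤s z≤n) (<⇒≤ (top<N b≤q)))))

  edge-1-2 : ∀ {b c F} → F ⊆ 1 ∷ 2 ∷ [] → DeltaC p b c F
  edge-1-2 F⊆ = sigma-in-Delta 0 (s≤s z≤n) (⊆-trans F⊆ edge⊆facet)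
    where
    edge⊆facet : 1 ∷ 2 ∷ [] ⊆ sigma-facet 1
    edge⊆facet (here refl) = here (sym (bar-id (s≤s z≤n) (s≤s z≤n)))
    edge⊆facet (there (here refl)) = there (here (sym (bar-id (s≤s z≤n) (<⇒≤ (mid<N z≤n)))))

  part-i : ∀ {b c} → 1 ≤ b → b ≤ q →
    (DeltaC p b c ∩ ⟨ Gf b ∷ [] ⟩) ≅ ⟨ (1 ∷ 2 + 3 * b ∷ []) ∷ (2 + 3 * b ∷ 3 + 3 * b ∷ []) ∷ [] ⟩
  part-i {b} {c} 1≤b b≤q = restrict-to-triangle (DeltaC p b c)
    (λ { (here refl) → here refl ; (there (here refl)) → there (here refl) })
    there
    (edge-1-mid 1≤b b≤q) (edge-mid-top b≤q)
    (λ ΔF F⊆G → cut-path F⊆G (Delta-avoids 1≤b b≤q z≤n ΔF))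

  part-ii : ∀ {b c} → 1 ≤ b → b ≤ q →
    ((DeltaC p b c ∪ ⟨ Gf b ∷ [] ⟩) ∩ ⟨ (1 ∷ 2 ∷ 3 + 3 * b ∷ []) ∷ [] ⟩)
      ≅ ⟨ (1 ∷ 2 ∷ []) ∷ (1 ∷ 3 + 3 * b ∷ []) ∷ [] ⟩
  part-ii {b} {c} 1≤b b≤q = restrict-to-triangle (DeltaC p b c ∪ ⟨ Gf b ∷ [] ⟩)
    (λ { (here refl) → here refl ; (there (here refl)) → there (here refl) })
    edge⊆triangle
    (λ F⊆ → inj₁ (edge-1-2 F⊆))
    (λ F⊆ → inj₂ (here (⊆-trans F⊆ edge⊆G)))
    split
    where
    edge⊆triangle : 1 ∷ 3 + 3 * b ∷ [] ⊆ 1 ∷ 2 ∷ 3 + 3 * b ∷ []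
    edge⊆triangle (here refl) = here refl
    edge⊆triangle (there (here refl)) = there (there (here refl))
    edge⊆G : 1 ∷ 3 + 3 * b ∷ [] ⊆ Gf b
    edge⊆G (here refl) = here refl
    edge⊆G (there (here refl)) = there (there (here refl))
    avoids-2-top : ∀ {F} → (DeltaC p b c ∪ ⟨ Gf b ∷ [] ⟩) F → 2 ∈ F → 3 + 3 * b ∈ F → ⊥
    avoids-2-top (inj₁ ΔF) = Delta-avoids 1≤b b≤q (s≤s z≤n) ΔF
    avoids-2-top (inj₂ (here F⊆G)) 2∈F _ = 2∉G 1≤b (F⊆G 2∈F)
    reorder : 1 ∷ 2 ∷ 3 + 3 * b ∷ [] ⊆ 2 ∷ 1 ∷ 3 + 3 * b ∷ []
    reorder = ⊆-reflexive-↭ (swap 1 2 ↭-refl)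
    reorder-edge : 2 ∷ 1 ∷ [] ⊆ 1 ∷ 2 ∷ []
    reorder-edge = ⊆-reflexive-↭ (swap 2 1 ↭-refl)
    split : ∀ {F} → (DeltaC p b c ∪ ⟨ Gf b ∷ [] ⟩) F → F ⊆ 1 ∷ 2 ∷ 3 + 3 * b ∷ [] →
      F ⊆ 1 ∷ 2 ∷ [] ⊎ F ⊆ 1 ∷ 3 + 3 * b ∷ []
    split {F} KF F⊆T = Sum.map₁ (λ (F⊆21 : F ⊆ 2 ∷ 1 ∷ []) → ⊆-trans F⊆21 reorder-edge)
      (cut-path (⊆-trans F⊆T reorder) (avoids-2-top KF))

lemma3p4 : (p b c : ℕ) → 2 ≤ p → 1 ≤ b → b + c ≤ p ∸ 2 →
    ((DeltaC p b c ∩ ⟨ Gf b ∷ [] ⟩)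
        ≅ ⟨ (1 ∷ (2 + 3 * b) ∷ []) ∷ ((2 + 3 * b) ∷ (3 + 3 * b) ∷ []) ∷ [] ⟩)
    × (((DeltaC p b c ∪ ⟨ Gf b ∷ [] ⟩) ∩ ⟨ (1 ∷ 2 ∷ (3 + 3 * b) ∷ []) ∷ [] ⟩)
        ≅ ⟨ (1 ∷ 2 ∷ []) ∷ (1 ∷ (3 + 3 * b) ∷ []) ∷ [] ⟩)
lemma3p4 (suc (suc q)) b c (s≤s (s≤s z≤n)) 1≤b b+c≤q = Cycle.part-i q 1≤b b≤q , Cycle.part-ii q 1≤b b≤q
  where
  b≤q : b ≤ q
  b≤q = ≤-trans (m≤m+n b c) b+c≤q
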